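{- For integers $0<k<n$, the bipartite degree sequence $\bm h_k(n)$ is indecomposable.
   Context: Colour classes $A_n=\{a_1,\dots,a_n\}$ (first) and $B_n=\{b_1,\dots,b_n\}$ (second). $\bm h_0(n)(a_i)=n+1-i$, $\bm h_0(n)(b_i)=i$ ($i\in[1,n]$), and $\bm h_k(n)=\bm h_0(n)-k\cdot\mathbb{1}_{a_1}-k\cdot\mathbb{1}_{b_n}$, where $\mathbb{1}_x$ is the indicator vector of $x$. A bipartite graph $G$ with ordered colour classes $A,B$ is decomposable if there are partitions $A=A_1\sqcup A_2$, $B=B_1\sqcup B_2$ with $A_1\cup B_1\neq\emptyset$ and $A_2\cup B_2\neq\emptyset$ such that every vertex of $A_1$ is adjacent to every vertex of $B_2$ and no vertex of $A_2$ is adjacent to any vertex of $B_1$ (i.e.\ $G=G[A_1,B_1]\circ G[A_2,B_2]$ where $\circ$ adds all edges between the first class of the left factor and the second class of the right factor). A bipartite degree sequence is decomposable if it has a decomposable realization (it is known that then all its realizations are decomposable), and indecomposable otherwise. -}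

module Defs where

open import Data.Nat using (ℕ; zero; suc; _+_; _∸_)
open import Data.Fin using (Fin; toℕ)
open import Data.Bool using (Bool; true; false; if_then_else_)
open import Data.Vec using (tabulate)
open import Data.Vec using () renaming (sum to vsum)
open import Data.Product using (Σ; ∃; _×_)
open import Data.Sum using (_⊎_)
open import Relation.Binary.PropositionalEquality using (_≡_)
open import Relation.Nullary using (¬_)

-- A (simple) bipartite graph with ordered colour classes A = Fin m (first)
-- and B = Fin p (second), given by its biadjacency relation.
BipGraph : ℕ → ℕ → Set
BipGraph m p = Fin m → Fin p → Bool

indicator : Bool → ℕ
indicator true  = 1
indicator false = 0

degA : ∀ {m p} → BipGraph m p → Fin m → ℕ
degA {m} {p} G i = vsum (tabulate {n = p} (λ j → indicator (G i j)))

degB : ∀ {m p} → BipGraph m p → Fin p → ℕ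
degB {m} {p} G j = vsum (tabulate {n = m} (λ i → indicator (G i j)))

record BipDegSeq (m p : ℕ) : Set where
  constructor bds
  field
    dA : Fin m → ℕ
    dB : Fin p → ℕ

Realizes : ∀ {m p} → BipGraph m p → BipDegSeq m p → Set
Realizes G d = (∀ i → degA G i ≡ BipDegSeq.dA d i) × (∀ j → degB G j ≡ BipDegSeq.dB d j)

-- Decomposability of a bipartite graph.  A partition A = A₁ ⊔ A₂ is encoded by
-- sA : Fin m → Bool with A₁ = {i | sA i ≡ true}, A₂ = {i | sA i ≡ false};
-- similarly sB for B = B₁ ⊔ B₂.
Decomposable : ∀ {m p} → BipGraph m p → Set
Decomposable {m} {p} G =
  Σ (Fin m → Bool) λ sA → Σ (Fin p → Bool) λ sB →
    ((∃ λ i → sA i ≡ true) ⊎ (∃ λ j → sB j ≡ true)) ×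
    ((∃ λ i → sA i ≡ false) ⊎ (∃ λ j → sB j ≡ false)) ×
    (∀ i j → sA i ≡ true → sB j ≡ false → G i j ≡ true) ×
    (∀ i j → sA i ≡ false → sB j ≡ true → G i j ≡ false)

DecomposableSeq : ∀ {m p} → BipDegSeq m p → Set
DecomposableSeq {m} {p} d = Σ (BipGraph m p) λ G → Realizes G d × Decomposable G

IndecomposableSeq : ∀ {m p} → BipDegSeq m p → Set
IndecomposableSeq d = ¬ DecomposableSeq d

-- a_i (i ∈ [1,n]) is the element i-1 of Fin n, likewise b_i.
-- h_k(n)(a_i) = n+1-i - k·[i = 1],  h_k(n)(b_i) = i - k·[i = n].
isFirst : ∀ {n} → Fin n → Bool
isFirst i with toℕ i
... | zero  = true
... | suc _ = false

isLast : ∀ {n} → Fin n → Bool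
isLast {n} i with n ∸ toℕ i
... | suc zero = true
... | _        = false

h : ℕ → (n : ℕ) → BipDegSeq n n
h k n = bds
  (λ i → if isFirst i then (n ∸ toℕ i) ∸ k else n ∸ toℕ i)
  (λ j → if isLast j then suc (toℕ j) ∸ k else suc (toℕ j))

-- Suppose a realization of h_k(n) splits as G[A₁,B₁] ∘ G[A₂,B₂], and put a = |A₁|, b = |B₁|.
-- Counting the edges at A₁ in two ways gives Σ_{A₁} deg = Σ_{B₁} deg + a·|B₂|.  As a_i has degree
-- n + 1 − i and b_j degree j, apart from the corrections −k at a₁ and b_n, this is the identity
--   P + Q + b + k·[a₁ ∈ A₁] = a·b + k·[b_n ∈ B₁],
-- where P and Q are the sums of the 0-based indices of A₁ and B₁.  Now c distinct indices sum to at
-- least c(c−1)/2, to at least c(c+1)/2 if they avoid 0, and to at least c(c−3)/2 + n if they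
-- include n − 1.  Against 2ab ≤ a² + b² (and 2ab + a ≤ a² + b² + b), for 0 < k < n this leaves only
-- a = b = 0 or a = b = n, that is, one of the two parts is empty.
module Submission where

open import Data.Bool using (Bool; true; false; not)
open import Data.Empty using (⊥; ⊥-elim)
open import Data.Fin using (Fin; zero; suc; toℕ; fromℕ; inject₁)
open import Data.Fin.Properties using (toℕ<n; toℕ-fromℕ; toℕ-inject₁)
open import Data.List using ([]; _∷_)
open import Data.Nat
open import Data.Nat.Properties
open import Data.Nat.Tactic.RingSolver using (solve)
open import Data.Product using (_×_; _,_; ∃)
open import Data.Sum using (_⊎_; inj₁; inj₂)
open import Data.Vec using (tabulate) renaming (sum to vsum)
open import Function using (_∘_)
open import Relation.Binary.PropositionalEquality
open import Relation.Nullary using (¬_; yes; no; contradiction)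
open import Algebra.Properties.CommutativeSemigroup *-commutativeSemigroup using (x∙yz≈y∙xz)
open import Algebra.Properties.Semiring.Sum +-*-semiring
  using (sum; sum-syntax; sum-cong-≗; sum-init-last;
         ∑-distrib-+; ∑-comm; *-distribˡ-sum; *-distribʳ-sum)

open import Defs
open BipDegSeq

≤-by-gap : ∀ {x y} d → x + d ≡ y → x ≤ y
≤-by-gap {x} d refl = m≤m+n x d

2*[m*n]≤m*m+n*n : ∀ m n → 2 * (m * n) ≤ m * m + n * n
2*[m*n]≤m*m+n*n m n with ≤-total m n
... | inj₁ m≤n with m≤n⇒∃[o]m+o≡n m≤n
...   | d , refl = ≤-by-gap (d * d) (solve (m ∷ d ∷ []))
2*[m*n]≤m*m+n*n m n | inj₂ n≤m with m≤n⇒∃[o]m+o≡n n≤m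
...   | d , refl = ≤-by-gap (d * d) (solve (n ∷ d ∷ []))

-- (m − n)² ≥ m − n over the integers.
2*[m*n]+m≤m*m+n*n+n : ∀ m n → 2 * (m * n) + m ≤ m * m + n * n + n
2*[m*n]+m≤m*m+n*n+n m n with m ≤? n
... | yes m≤n with m≤n⇒∃[o]m+o≡n m≤n
...   | d , refl = ≤-by-gap (d * d + d) (solve (m ∷ d ∷ []))
2*[m*n]+m≤m*m+n*n+n m n | no m≰n with m≤n⇒∃[o]m+o≡n (≰⇒> m≰n)
...   | d , refl = ≤-by-gap (d * d + d) (solve (n ∷ d ∷ []))

vsum-tabulate : ∀ {n} (f : Fin n → ℕ) → vsum (tabulate f) ≡ sum f
vsum-tabulate {zero}  f = refl
vsum-tabulate {suc n} f = cong (f zero +_) (vsum-tabulate (f ∘ suc))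

∑∑≡∑*∑ : ∀ {m p} (f : Fin m → ℕ) (g : Fin p → ℕ) →
         ∑[ i < m ] ∑[ j < p ] (f i * g j) ≡ sum f * sum g
∑∑≡∑*∑ f g = trans (sum-cong-≗ (λ i → sym (*-distribˡ-sum (f i) g)))
                   (sym (*-distribʳ-sum (sum g) f))

∑∑-distrib-+ : ∀ {m p} (f g : Fin m → Fin p → ℕ) →
               ∑[ i < m ] ∑[ j < p ] (f i j + g i j)
                 ≡ ∑[ i < m ] ∑[ j < p ] f i j + ∑[ i < m ] ∑[ j < p ] g i j
∑∑-distrib-+ {m} {p} f g = trans (sum-cong-≗ (λ i → ∑-distrib-+ (f i) (g i)))
                                 (∑-distrib-+ (λ i → ∑[ j < p ] f i j) (λ i → ∑[ j < p ] g i j))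

size : ∀ {n} → (Fin n → Bool) → ℕ
size s = sum (indicator ∘ s)

sumOver : ∀ {n} → (Fin n → Bool) → (Fin n → ℕ) → ℕ
sumOver s f = sum (λ i → indicator (s i) * f i)

positions : ∀ {n} → (Fin n → Bool) → ℕ
positions s = sumOver s toℕ

size≤n : ∀ {n} (s : Fin n → Bool) → size s ≤ n
size≤n {zero}  s = z≤n
size≤n {suc n} s with s zero
... | true  = s≤s (size≤n (s ∘ suc))
... | false = m≤n⇒m≤1+n (size≤n (s ∘ suc))

∈⇒0<size : ∀ {n} (s : Fin n → Bool) {i} → s i ≡ true → 0 < size s
∈⇒0<size s {zero}  i∈s rewrite i∈s = s≤s z≤n
∈⇒0<size s {suc i} i∈s = ≤-trans (∈⇒0<size (s ∘ suc) i∈s) (m≤n+m _ (indicator (s zero)))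

∉⇒size<n : ∀ {n} (s : Fin n → Bool) {i} → s i ≡ false → size s < n
∉⇒size<n s {zero}  i∉s rewrite i∉s = s≤s (size≤n (s ∘ suc))
∉⇒size<n s {suc i} i∉s with s zero
... | true  = s≤s (∉⇒size<n (s ∘ suc) i∉s)
... | false = m<n⇒m<1+n (∉⇒size<n (s ∘ suc) i∉s)

size+size∘not≡n : ∀ {n} (s : Fin n → Bool) → size s + size (not ∘ s) ≡ n
size+size∘not≡n {zero}  s = refl
size+size∘not≡n {suc n} s with s zero
... | true  = cong suc (size+size∘not≡n (s ∘ suc))
... | false = trans (+-suc _ _) (cong suc (size+size∘not≡n (s ∘ suc)))

sumOver-cong : ∀ {n} (s : Fin n → Bool) {f g : Fin n → ℕ} →
               (∀ i → f i ≡ g i) → sumOver s f ≡ sumOver s g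
sumOver-cong s f≗g = sum-cong-≗ (λ i → cong (indicator (s i) *_) (f≗g i))

sumOver-+ : ∀ {n} (s : Fin n → Bool) (f g : Fin n → ℕ) →
            sumOver s (λ i → f i + g i) ≡ sumOver s f + sumOver s g
sumOver-+ s f g = trans (sum-cong-≗ (λ i → *-distribˡ-+ (indicator (s i)) (f i) (g i)))
                        (∑-distrib-+ (λ i → indicator (s i) * f i) (λ i → indicator (s i) * g i))

sumOver-*ˡ : ∀ {n} (s : Fin n → Bool) c (f : Fin n → ℕ) → sumOver s (λ i → c * f i) ≡ c * sumOver s f
sumOver-*ˡ s c f = trans (sum-cong-≗ (λ i → x∙yz≈y∙xz (indicator (s i)) c (f i)))
                         (sym (*-distribˡ-sum c (λ i → indicator (s i) * f i)))

sumOver-const : ∀ {n} (s : Fin n → Bool) c → sumOver s (λ _ → c) ≡ size s * c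
sumOver-const s c = sym (*-distribʳ-sum c (indicator ∘ s))

sumOver-zero : ∀ {n} (s : Fin n → Bool) → sumOver s (λ _ → 0) ≡ 0
sumOver-zero s = trans (sumOver-const s 0) (*-zeroʳ (size s))

sumOver-suc∘toℕ : ∀ {n} (s : Fin n → Bool) → sumOver s (suc ∘ toℕ) ≡ positions s + size s
sumOver-suc∘toℕ s = trans (sum-cong-≗ (λ i → trans (*-suc (indicator (s i)) (toℕ i))
                                                     (+-comm (indicator (s i)) _)))
                          (∑-distrib-+ (λ i → indicator (s i) * toℕ i) (indicator ∘ s))

positions-suc : ∀ {n} (s : Fin (suc n) → Bool) → positions s ≡ positions (s ∘ suc) + size (s ∘ suc)
positions-suc s = trans (cong (_+ sumOver (s ∘ suc) (suc ∘ toℕ)) (*-zeroʳ (indicator (s zero))))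
                        (sumOver-suc∘toℕ (s ∘ suc))

size-last : ∀ {m} (s : Fin (suc m) → Bool) → size s ≡ size (s ∘ inject₁) + indicator (s (fromℕ m))
size-last s = sum-init-last (indicator ∘ s)

positions-last : ∀ {m} (s : Fin (suc m) → Bool) →
                 positions s ≡ positions (s ∘ inject₁) + indicator (s (fromℕ m)) * m
positions-last {m} s = trans (sum-init-last (λ i → indicator (s i) * toℕ i))
  (cong₂ _+_ (sumOver-cong (s ∘ inject₁) toℕ-inject₁) (cong (indicator (s (fromℕ m)) *_) (toℕ-fromℕ m)))

size*size≤2*positions+size : ∀ {n} (s : Fin n → Bool) → size s * size s ≤ 2 * positions s + size s
size*size≤2*positions+size {zero}  s = z≤n
size*size≤2*positions+size {suc n} s =
  subst (λ x → size s * size s ≤ 2 * x + size s) (sym (positions-suc s))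
        (prepend (s zero) (size (s ∘ suc)) (positions (s ∘ suc)) (size*size≤2*positions+size (s ∘ suc)))
  where
  open ≤-Reasoning
  prepend : ∀ b c P → c * c ≤ 2 * P + c →
            (indicator b + c) * (indicator b + c) ≤ 2 * (P + c) + (indicator b + c)
  prepend false c P ih = ≤-trans ih (+-monoˡ-≤ c (*-monoʳ-≤ 2 (m≤m+n P c)))
  prepend true  c P ih = begin
    suc c * suc c           ≡⟨ solve (c ∷ []) ⟩
    c * c + (2 * c + 1)     ≤⟨ +-monoˡ-≤ (2 * c + 1) ih ⟩
    2 * P + c + (2 * c + 1) ≡⟨ solve (P ∷ c ∷ []) ⟩
    2 * (P + c) + suc c     ∎

size*size+size≤2*positions : ∀ {m} (s : Fin (suc m) → Bool) → s zero ≡ false →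
                             size s * size s + size s ≤ 2 * positions s
size*size+size≤2*positions s 0∉s rewrite positions-suc s | 0∉s =
  drop-zero (size (s ∘ suc)) (positions (s ∘ suc)) (size*size≤2*positions+size (s ∘ suc))
  where
  open ≤-Reasoning
  drop-zero : ∀ c P → c * c ≤ 2 * P + c → c * c + c ≤ 2 * (P + c)
  drop-zero c P ih = begin
    c * c + c      ≤⟨ +-monoˡ-≤ c ih ⟩
    2 * P + c + c  ≡⟨ solve (P ∷ c ∷ []) ⟩
    2 * (P + c)    ∎

size*size+2*n≤2*positions+3*size : ∀ {m} (s : Fin (suc m) → Bool) → s (fromℕ m) ≡ true →
                                   size s * size s + 2 * suc m ≤ 2 * positions s + 3 * size s
size*size+2*n≤2*positions+3*size {m} s last∈s rewrite size-last s | positions-last s | last∈s =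
  append-last (size (s ∘ inject₁)) (positions (s ∘ inject₁)) (size*size≤2*positions+size (s ∘ inject₁))
  where
  open ≤-Reasoning
  append-last : ∀ c P → c * c ≤ 2 * P + c → (c + 1) * (c + 1) + 2 * suc m ≤ 2 * (P + 1 * m) + 3 * (c + 1)
  append-last c P ih = begin
    (c + 1) * (c + 1) + 2 * suc m    ≡⟨ solve (c ∷ m ∷ []) ⟩
    c * c + (2 * c + 2 * m + 3)      ≤⟨ +-monoˡ-≤ (2 * c + 2 * m + 3) ih ⟩
    2 * P + c + (2 * c + 2 * m + 3)  ≡⟨ solve (P ∷ c ∷ m ∷ []) ⟩
    2 * (P + 1 * m) + 3 * (c + 1)    ∎

isLast⇒suc[toℕ]≡n : ∀ {n} (j : Fin n) → isLast j ≡ true → suc (toℕ j) ≡ n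
isLast⇒suc[toℕ]≡n {n} j last with n ∸ toℕ j in n∸j≡1
... | suc zero = trans (cong (_+ toℕ j) (sym n∸j≡1)) (m∸n+n≡m (<⇒≤ (toℕ<n j)))

suc[toℕ]≡n⇒isLast : ∀ {n} (j : Fin n) → suc (toℕ j) ≡ n → isLast j ≡ true
suc[toℕ]≡n⇒isLast {n} j j+1≡n =
  n∸j≡1⇒isLast (trans (cong (_∸ toℕ j) (sym j+1≡n)) (m+n∸n≡m 1 (toℕ j)))
  where
  n∸j≡1⇒isLast : n ∸ toℕ j ≡ 1 → isLast j ≡ true
  n∸j≡1⇒isLast n∸j≡1 with n ∸ toℕ j
  n∸j≡1⇒isLast refl | .1 = refl

isLast-fromℕ : ∀ m → isLast (fromℕ m) ≡ true
isLast-fromℕ m = suc[toℕ]≡n⇒isLast (fromℕ m) (cong suc (toℕ-fromℕ m))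

isLast-inject₁ : ∀ {m} (j : Fin m) → isLast (inject₁ j) ≡ false
isLast-inject₁ {m} j with isLast (inject₁ j) in last
... | false = refl
... | true  = contradiction (trans (sym (toℕ-inject₁ j)) (suc-injective (isLast⇒suc[toℕ]≡n (inject₁ j) last)))
                            (<⇒≢ (toℕ<n j))

sumOver-isFirst : ∀ {m} (s : Fin (suc m) → Bool) → sumOver s (indicator ∘ isFirst) ≡ indicator (s zero)
sumOver-isFirst s = trans (cong₂ _+_ (*-identityʳ (indicator (s zero))) (sumOver-zero (s ∘ suc)))
                          (+-identityʳ (indicator (s zero)))

sumOver-isLast : ∀ {m} (s : Fin (suc m) → Bool) → sumOver s (indicator ∘ isLast) ≡ indicator (s (fromℕ m))
sumOver-isLast {m} s = trans (sum-init-last (λ j → indicator (s j) * indicator (isLast j)))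
  (cong₂ _+_ (trans (sumOver-cong (s ∘ inject₁) (cong indicator ∘ isLast-inject₁))
                    (sumOver-zero (s ∘ inject₁)))
             (trans (cong (λ b → indicator (s (fromℕ m)) * indicator b) (isLast-fromℕ m))
                    (*-identityʳ (indicator (s (fromℕ m))))))

dA-h-identity : ∀ {k m} → k ≤ suc m → ∀ i → dA (h k (suc m)) i + toℕ i + k * indicator (isFirst i) ≡ suc m
dA-h-identity {k} k≤n zero    = trans (cong₂ _+_ (+-identityʳ _) (*-identityʳ k)) (m∸n+n≡m k≤n)
dA-h-identity {k} {m} k≤n (suc i) = trans (cong (m ∸ toℕ i + suc (toℕ i) +_) (*-zeroʳ k))
                                      (trans (+-identityʳ _) (m∸n+n≡m (<⇒≤ (toℕ<n (suc i)))))

dB-h-identity : ∀ {k n} → k ≤ n → ∀ j → dB (h k n) j + k * indicator (isLast j) ≡ suc (toℕ j)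
dB-h-identity {k} k≤n j with isLast j in last
... | true  = trans (cong (suc (toℕ j) ∸ k +_) (*-identityʳ k))
                    (m∸n+n≡m (≤-trans k≤n (≤-reflexive (sym (isLast⇒suc[toℕ]≡n j last)))))
... | false = trans (cong (suc (toℕ j) +_) (*-zeroʳ k)) (+-identityʳ (suc (toℕ j)))

sumOver-h-dA : ∀ {k m} → k ≤ suc m → (s : Fin (suc m) → Bool) →
               sumOver s (dA (h k (suc m))) + positions s + k * indicator (s zero) ≡ size s * suc m
sumOver-h-dA {k} {m} k≤n s = begin
  sumOver s d + positions s + k * indicator (s zero)
    ≡⟨ cong (λ x → sumOver s d + positions s + k * x) (sumOver-isFirst s) ⟨
  sumOver s d + positions s + k * sumOver s (indicator ∘ isFirst)
    ≡⟨ cong₂ _+_ (sumOver-+ s d toℕ) (sumOver-*ˡ s k (indicator ∘ isFirst)) ⟨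
  sumOver s (λ i → d i + toℕ i) + sumOver s (λ i → k * indicator (isFirst i))
    ≡⟨ sumOver-+ s (λ i → d i + toℕ i) (λ i → k * indicator (isFirst i)) ⟨
  sumOver s (λ i → d i + toℕ i + k * indicator (isFirst i))
    ≡⟨ sumOver-cong s (dA-h-identity k≤n) ⟩
  sumOver s (λ _ → suc m)
    ≡⟨ sumOver-const s (suc m) ⟩
  size s * suc m ∎
  where
  open ≡-Reasoning
  d = dA (h k (suc m))

sumOver-h-dB : ∀ {k m} → k ≤ suc m → (s : Fin (suc m) → Bool) →
               sumOver s (dB (h k (suc m))) + k * indicator (s (fromℕ m)) ≡ positions s + size s
sumOver-h-dB {k} {m} k≤n s = begin
  sumOver s d + k * indicator (s (fromℕ m))
    ≡⟨ cong (λ x → sumOver s d + k * x) (sumOver-isLast s) ⟨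
  sumOver s d + k * sumOver s (indicator ∘ isLast)
    ≡⟨ cong (sumOver s d +_) (sumOver-*ˡ s k (indicator ∘ isLast)) ⟨
  sumOver s d + sumOver s (λ j → k * indicator (isLast j))
    ≡⟨ sumOver-+ s d (λ j → k * indicator (isLast j)) ⟨
  sumOver s (λ j → d j + k * indicator (isLast j))
    ≡⟨ sumOver-cong s (dB-h-identity k≤n) ⟩
  sumOver s (suc ∘ toℕ)
    ≡⟨ sumOver-suc∘toℕ s ⟩
  positions s + size s ∎
  where
  open ≡-Reasoning
  d = dB (h k (suc m))

sumOver-degA : ∀ {m p} (G : BipGraph m p) (s : Fin m → Bool) →
               sumOver s (degA G) ≡ ∑[ i < m ] ∑[ j < p ] (indicator (s i) * indicator (G i j))
sumOver-degA G s = sum-cong-≗ (λ i → trans (cong (indicator (s i) *_) (vsum-tabulate (λ j → indicator (G i j))))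
                                           (*-distribˡ-sum (indicator (s i)) (λ j → indicator (G i j))))

sumOver-degB : ∀ {m p} (G : BipGraph m p) (s : Fin p → Bool) →
               sumOver s (degB G) ≡ ∑[ j < p ] ∑[ i < m ] (indicator (s j) * indicator (G i j))
sumOver-degB G s = sum-cong-≗ (λ j → trans (cong (indicator (s j) *_) (vsum-tabulate (λ i → indicator (G i j))))
                                           (*-distribˡ-sum (indicator (s j)) (λ i → indicator (G i j))))

-- An edge at A₁ either ends in B₁, which sees only A₁, or in B₂, where all of A₁ × B₂ are edges.
decomposition-degreeSum :
  ∀ {m p} (G : BipGraph m p) (sA : Fin m → Bool) (sB : Fin p → Bool) →
  (∀ i j → sA i ≡ true → sB j ≡ false → G i j ≡ true) →
  (∀ i j → sA i ≡ false → sB j ≡ true → G i j ≡ false) →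
  sumOver sA (degA G) ≡ sumOver sB (degB G) + size sA * size (not ∘ sB)
decomposition-degreeSum {m} {p} G sA sB complete empty = begin
  sumOver sA (degA G)
    ≡⟨ sumOver-degA G sA ⟩
  ∑[ i < m ] ∑[ j < p ] (indicator (sA i) * g i j)
    ≡⟨ sum-cong-≗ (λ i → sum-cong-≗ (edge-split i)) ⟩
  ∑[ i < m ] ∑[ j < p ] (toB₁ i j + toB₂ i j)
    ≡⟨ ∑∑-distrib-+ toB₁ toB₂ ⟩
  ∑[ i < m ] ∑[ j < p ] toB₁ i j + ∑[ i < m ] ∑[ j < p ] toB₂ i j
    ≡⟨ cong₂ _+_ (∑-comm toB₁) (∑∑≡∑*∑ (indicator ∘ sA) (indicator ∘ not ∘ sB)) ⟩
  ∑[ j < p ] ∑[ i < m ] toB₁ i j + size sA * size (not ∘ sB)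
    ≡⟨ cong (_+ size sA * size (not ∘ sB)) (sumOver-degB G sB) ⟨
  sumOver sB (degB G) + size sA * size (not ∘ sB) ∎
  where
  open ≡-Reasoning
  g : Fin m → Fin p → ℕ
  g i j = indicator (G i j)
  toB₁ toB₂ : Fin m → Fin p → ℕ
  toB₁ i j = indicator (sB j) * g i j
  toB₂ i j = indicator (sA i) * indicator (not (sB j))
  edge-split : ∀ i j → indicator (sA i) * g i j ≡ toB₁ i j + toB₂ i j
  edge-split i j with sA i in i∈A₁ | sB j in j∈B₁
  ... | true  | true  = sym (+-identityʳ (1 * g i j))
  ... | true  | false rewrite complete i j i∈A₁ j∈B₁ = refl
  ... | false | true  rewrite empty i j i∈A₁ j∈B₁ = refl
  ... | false | false = refl

realization-degreeSum :
  ∀ {m p} {G : BipGraph m p} {d : BipDegSeq m p} → Realizes G d →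
  (sA : Fin m → Bool) (sB : Fin p → Bool) →
  (∀ i j → sA i ≡ true → sB j ≡ false → G i j ≡ true) →
  (∀ i j → sA i ≡ false → sB j ≡ true → G i j ≡ false) →
  sumOver sA (dA d) ≡ sumOver sB (dB d) + size sA * size (not ∘ sB)
realization-degreeSum {G = G} {d} (degA≡ , degB≡) sA sB complete empty = begin
  sumOver sA (dA d)                                 ≡⟨ sumOver-cong sA degA≡ ⟨
  sumOver sA (degA G)                               ≡⟨ decomposition-degreeSum G sA sB complete empty ⟩
  sumOver sB (degB G) + size sA * size (not ∘ sB)   ≡⟨ cong (_+ _) (sumOver-cong sB degB≡) ⟩
  sumOver sB (dB d) + size sA * size (not ∘ sB)     ∎
  where open ≡-Reasoning

degreeSums⇒position-identity : ∀ {ΣA ΣB P Q a b b̄ n kα kβ} →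
  ΣA ≡ ΣB + a * b̄ → ΣA + P + kα ≡ a * n → ΣB + kβ ≡ Q + b → b + b̄ ≡ n →
  P + Q + b + kα ≡ a * b + kβ
degreeSums⇒position-identity {ΣB = ΣB} {P} {Q} {a} {b} {b̄} {kα = kα} {kβ} refl eqA eqB refl =
  +-cancelˡ-≡ (ΣB + a * b̄) (P + Q + b + kα) (a * b + kβ) (begin
    ΣB + a * b̄ + (P + Q + b + kα)  ≡⟨ solve (ΣB ∷ a ∷ b̄ ∷ P ∷ Q ∷ b ∷ kα ∷ []) ⟩
    ΣB + a * b̄ + P + kα + (Q + b)  ≡⟨ cong (_+ (Q + b)) eqA ⟩
    a * (b + b̄) + (Q + b)          ≡⟨ cong (a * (b + b̄) +_) eqB ⟨
    a * (b + b̄) + (ΣB + kβ)        ≡⟨ solve (ΣB ∷ a ∷ b̄ ∷ b ∷ kβ ∷ []) ⟩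
    ΣB + a * b̄ + (a * b + kβ)      ∎)
  where open ≡-Reasoning

module _ (a b P Q : ℕ) where
  open ≤-Reasoning

  no-boundary-split : P + Q + b ≡ a * b → a * a + a ≤ 2 * P → b * b ≤ 2 * Q + b → a + b ≡ 0
  no-boundary-split E Pbound Qbound = n≤0⇒n≡0 (+-cancelˡ-≤ (2 * (a * b)) (a + b) 0 (begin
    2 * (a * b) + (a + b)       ≤⟨ +-monoˡ-≤ (a + b) (2*[m*n]≤m*m+n*n a b) ⟩
    a * a + b * b + (a + b)     ≡⟨ solve (a ∷ b ∷ []) ⟩
    (a * a + a) + (b * b + b)   ≤⟨ +-mono-≤ Pbound (+-monoˡ-≤ b Qbound) ⟩
    2 * P + (2 * Q + b + b)     ≡⟨ solve (P ∷ Q ∷ b ∷ []) ⟩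
    2 * (P + Q + b)             ≡⟨ cong (2 *_) E ⟩
    2 * (a * b)                 ≡⟨ +-identityʳ (2 * (a * b)) ⟨
    2 * (a * b) + 0             ∎))

  first-only-split : ∀ {k} → 0 < k → P + Q + b + k ≡ a * b → a * a ≤ 2 * P + a → b * b ≤ 2 * Q + b → ⊥
  first-only-split {k} 0<k E Pbound Qbound =
    <⇒≱ (*-monoʳ-< 2 0<k) (+-cancelˡ-≤ (2 * (a * b) + a) (2 * k) 0 (begin
      2 * (a * b) + a + 2 * k            ≤⟨ +-monoˡ-≤ (2 * k) (2*[m*n]+m≤m*m+n*n+n a b) ⟩
      a * a + b * b + b + 2 * k          ≡⟨ solve (a ∷ b ∷ k ∷ []) ⟩
      a * a + (b * b + b) + 2 * k        ≤⟨ +-monoˡ-≤ (2 * k) (+-mono-≤ Pbound (+-monoˡ-≤ b Qbound)) ⟩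
      2 * P + a + (2 * Q + b + b) + 2 * k ≡⟨ solve (a ∷ b ∷ P ∷ Q ∷ k ∷ []) ⟩
      2 * (P + Q + b + k) + a            ≡⟨ cong (λ x → 2 * x + a) E ⟩
      2 * (a * b) + a                    ≡⟨ +-identityʳ (2 * (a * b) + a) ⟨
      2 * (a * b) + a + 0                ∎))

  last-only-split : ∀ {k n} → k < n → P + Q + b ≡ a * b + k →
                    a * a + a ≤ 2 * P → b * b + 2 * n ≤ 2 * Q + 3 * b → ⊥
  last-only-split {k} {n} k<n E Pbound Qbound =
    <⇒≱ (*-monoʳ-< 2 k<n) (+-cancelˡ-≤ (2 * (a * b) + b) (2 * n) (2 * k) (begin
      2 * (a * b) + b + 2 * n            ≡⟨ solve (a ∷ b ∷ n ∷ []) ⟩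
      2 * (b * a) + b + 2 * n            ≤⟨ +-monoˡ-≤ (2 * n) (2*[m*n]+m≤m*m+n*n+n b a) ⟩
      b * b + a * a + a + 2 * n          ≡⟨ solve (a ∷ b ∷ n ∷ []) ⟩
      (a * a + a) + (b * b + 2 * n)      ≤⟨ +-mono-≤ Pbound Qbound ⟩
      2 * P + (2 * Q + 3 * b)            ≡⟨ solve (b ∷ P ∷ Q ∷ []) ⟩
      2 * (P + Q + b) + b                ≡⟨ cong (λ x → 2 * x + b) E ⟩
      2 * (a * b + k) + b                ≡⟨ solve (a ∷ b ∷ k ∷ []) ⟩
      2 * (a * b) + b + 2 * k            ∎))

  both-boundaries-split : ∀ {n} → a ≤ n → b ≤ n → P + Q + b ≡ a * b →
                          a * a ≤ 2 * P + a → b * b + 2 * n ≤ 2 * Q + 3 * b → a ≡ n × b ≡ n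
  both-boundaries-split {n} a≤n b≤n E Pbound Qbound =
    ≤-antisym a≤n (+-cancelʳ-≤ n n a (begin
      n + n   ≤⟨ n+n≤a+b ⟩
      a + b   ≤⟨ +-monoʳ-≤ a b≤n ⟩
      a + n   ∎)) ,
    ≤-antisym b≤n (+-cancelˡ-≤ n n b (begin
      n + n   ≤⟨ n+n≤a+b ⟩
      a + b   ≤⟨ +-monoˡ-≤ b a≤n ⟩
      n + b   ∎))
    where
    n+n≤a+b : n + n ≤ a + b
    n+n≤a+b = +-cancelˡ-≤ (2 * (a * b)) (n + n) (a + b) (begin
      2 * (a * b) + (n + n)          ≡⟨ solve (a ∷ b ∷ n ∷ []) ⟩
      2 * (a * b) + 2 * n            ≤⟨ +-monoˡ-≤ (2 * n) (2*[m*n]≤m*m+n*n a b) ⟩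
      a * a + b * b + 2 * n          ≡⟨ solve (a ∷ b ∷ n ∷ []) ⟩
      a * a + (b * b + 2 * n)        ≤⟨ +-mono-≤ Pbound Qbound ⟩
      2 * P + a + (2 * Q + 3 * b)    ≡⟨ solve (a ∷ b ∷ P ∷ Q ∷ []) ⟩
      2 * (P + Q + b) + (a + b)      ≡⟨ cong (λ x → 2 * x + (a + b)) E ⟩
      2 * (a * b) + (a + b)          ∎)

position-identity⇒trivial-sizes : ∀ {k n a b P Q} (α β : Bool) → 0 < k → k < n → a ≤ n → b ≤ n →
                P + Q + b + k * indicator α ≡ a * b + k * indicator β →
                (α ≡ false → a * a + a ≤ 2 * P) → a * a ≤ 2 * P + a →
                (β ≡ true → b * b + 2 * n ≤ 2 * Q + 3 * b) → b * b ≤ 2 * Q + b →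
                (a ≡ 0 × b ≡ 0) ⊎ (a ≡ n × b ≡ n)
position-identity⇒trivial-sizes {k} {a = a} {b} {P} {Q} false false _ _ _ _ E Pfree _ _ Qbound =
  inj₁ (m+n≡0⇒m≡0 a a+b≡0 , m+n≡0⇒n≡0 a a+b≡0)
  where
  a+b≡0 : a + b ≡ 0
  a+b≡0 = no-boundary-split a b P Q (+-cancelʳ-≡ (k * 0) (P + Q + b) (a * b) E) (Pfree refl) Qbound
position-identity⇒trivial-sizes {k} {a = a} {b} {P} {Q} true false 0<k _ _ _ E _ Pbound _ Qbound
  rewrite *-identityʳ k | *-zeroʳ k | +-identityʳ (a * b) =
  ⊥-elim (first-only-split a b P Q 0<k E Pbound Qbound)
position-identity⇒trivial-sizes {k} {a = a} {b} {P} {Q} false true _ k<n _ _ E Pfree _ Qlast _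
  rewrite *-zeroʳ k | *-identityʳ k | +-identityʳ (P + Q + b) =
  ⊥-elim (last-only-split a b P Q k<n E (Pfree refl) (Qlast refl))
position-identity⇒trivial-sizes {k} {a = a} {b} {P} {Q} true true _ _ a≤n b≤n E _ Pbound Qlast _ =
  inj₂ (both-boundaries-split a b P Q a≤n b≤n (+-cancelʳ-≡ (k * 1) (P + Q + b) (a * b) E) Pbound (Qlast refl))

position-identity :
  ∀ {k m} → k ≤ suc m → {G : BipGraph (suc m) (suc m)} → Realizes G (h k (suc m)) →
  (sA sB : Fin (suc m) → Bool) →
  (∀ i j → sA i ≡ true → sB j ≡ false → G i j ≡ true) →
  (∀ i j → sA i ≡ false → sB j ≡ true → G i j ≡ false) →
  positions sA + positions sB + size sB + k * indicator (sA zero)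
    ≡ size sA * size sB + k * indicator (sB (fromℕ m))
position-identity {k} {m} k≤n realizes sA sB complete empty =
  degreeSums⇒position-identity {ΣB = sumOver sB (dB (h k (suc m)))} {a = size sA} {b̄ = size (not ∘ sB)}
    (realization-degreeSum realizes sA sB complete empty)
    (sumOver-h-dA k≤n sA)
    (sumOver-h-dB k≤n sB)
    (size+size∘not≡n sB)

nonempty-parts⇒nontrivial-sizes :
  ∀ {n} (sA sB : Fin n → Bool) →
  (∃ λ i → sA i ≡ true) ⊎ (∃ λ j → sB j ≡ true) →
  (∃ λ i → sA i ≡ false) ⊎ (∃ λ j → sB j ≡ false) →
  ¬ ((size sA ≡ 0 × size sB ≡ 0) ⊎ (size sA ≡ n × size sB ≡ n))
nonempty-parts⇒nontrivial-sizes sA sB (inj₁ (_ , i∈A₁)) _ (inj₁ (a≡0 , _)) =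
  <-irrefl (sym a≡0) (∈⇒0<size sA i∈A₁)
nonempty-parts⇒nontrivial-sizes sA sB (inj₂ (_ , j∈B₁)) _ (inj₁ (_ , b≡0)) =
  <-irrefl (sym b≡0) (∈⇒0<size sB j∈B₁)
nonempty-parts⇒nontrivial-sizes sA sB _ (inj₁ (_ , i∈A₂)) (inj₂ (a≡n , _)) =
  <-irrefl a≡n (∉⇒size<n sA i∈A₂)
nonempty-parts⇒nontrivial-sizes sA sB _ (inj₂ (_ , j∈B₂)) (inj₂ (_ , b≡n)) =
  <-irrefl b≡n (∉⇒size<n sB j∈B₂)

mainTheorem4 : (k n : ℕ) → 0 < k → k < n → IndecomposableSeq (h k n)
mainTheorem4 k (suc m) 0<k k<n (G , realizes , sA , sB , A₁∪B₁≢∅ , A₂∪B₂≢∅ , complete , empty) =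
  nonempty-parts⇒nontrivial-sizes sA sB A₁∪B₁≢∅ A₂∪B₂≢∅
    (position-identity⇒trivial-sizes {P = positions sA} {positions sB} (sA zero) (sB (fromℕ m))
      0<k k<n (size≤n sA) (size≤n sB)
      (position-identity k≤n realizes sA sB complete empty)
      (size*size+size≤2*positions sA) (size*size≤2*positions+size sA)
      (size*size+2*n≤2*positions+3*size sB) (size*size≤2*positions+size sB))
  where
  k≤n : k ≤ suc m
  k≤n = <⇒≤ k<n
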